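{- Let $(X,\mathcal{B})$ be a non-trivial symmetric design with parameters $(v,k,\lambda)$ admitting a null polarity $\sigma$, let $\Gamma$ be its incidence graph, and let $\Delta$ be the corresponding graph on $X$ in which distinct $x,y$ are adjacent iff $x\in\sigma(y)$ (a strongly regular graph with parameters $(v,k,\lambda,\lambda)$). Then $\mu(\Gamma)\le 2\mu(\Delta)$.
   Context: A symmetric $(v,k,\lambda)$ design is a set $X$ of $v$ points and a family $\mathcal{B}$ of $k$-subsets (blocks) such that any two distinct points lie in exactly $\lambda$ blocks and any two distinct blocks meet in exactly $\lambda$ points (so $|\mathcal{B}|=v$); non-trivial means $1<k<v-1$. Its incidence graph is the bipartite graph on $X\cup\mathcal{B}$ with $x\sim B$ iff $x\in B$. A polarity is a bijection $\sigma:X\to\mathcal{B}$ with $x\in\sigma(y)\iff y\in\sigma(x)$ for all $x,y$; it is null if $x\notin\sigma(x)$ for all $x$. $\mu$ denotes metric dimension: the minimum size of a vertex set $R$ such that any two distinct vertices $u,w$ have some $r\in R$ with $\d(u,r)\ne\d(w,r)$, where $\d$ is path distance. -}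

module Defs where

open import Data.Nat using (ℕ; zero; suc; _+_; _<_; _≤_)
open import Data.Bool using (Bool; true; false; _∧_; if_then_else_)
open import Data.Fin using (Fin; zero; suc; splitAt)
open import Data.Fin.Subset using (Subset; _∈_; ∣_∣)
open import Data.Maybe using (Maybe; just; nothing)
open import Data.Product using (Σ; _×_; ∃; ∃-syntax)
open import Data.Sum using (inj₁; inj₂)
open import Relation.Nullary using (¬_)
open import Relation.Nullary.Decidable using (⌊_⌋)
open import Relation.Binary.PropositionalEquality using (_≡_; _≢_)
open import Function.Definitions using (Bijective)
import Data.Fin as F

count : ∀ {n} → (Fin n → Bool) → ℕ
count {zero}  p = 0
count {suc n} p = (if p zero then 1 else 0) + count (λ i → p (suc i))

-- Symmetric designs.  Points are Fin v, blocks are indexed by Fin v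
-- (a symmetric design has exactly v blocks); inc x B = true iff x ∈ B.

record IsSymmetricDesign (v k lam : ℕ) (inc : Fin v → Fin v → Bool) : Set where
  field
    blockSize  : ∀ B → count (λ x → inc x B) ≡ k
    pointPairs : ∀ x y → x ≢ y → count (λ B → inc x B ∧ inc y B) ≡ lam
    blockPairs : ∀ B C → B ≢ C → count (λ x → inc x B ∧ inc x C) ≡ lam

NonTrivial : (v k : ℕ) → Set
NonTrivial v k = 1 < k × suc k < v

record IsPolarity {v} (inc : Fin v → Fin v → Bool) (σ : Fin v → Fin v) : Set where
  field
    bijective : Bijective _≡_ _≡_ σ
    symmetric : ∀ x y → inc x (σ y) ≡ inc y (σ x)

IsNull : ∀ {v} (inc : Fin v → Fin v → Bool) (σ : Fin v → Fin v) → Set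
IsNull inc σ = ∀ x → inc x (σ x) ≡ false

Graph : ℕ → Set
Graph n = Fin n → Fin n → Bool

data Walk {n} (G : Graph n) : ℕ → Fin n → Fin n → Set where
  []  : ∀ {u} → Walk G 0 u u
  _∷_ : ∀ {m u x w} → G u x ≡ true → Walk G m x w → Walk G (suc m) u w

-- path distance; nothing = ∞ (no walk at all)
data Dist {n} (G : Graph n) (u w : Fin n) : Maybe ℕ → Set where
  finite   : ∀ {m} → Walk G m u w → (∀ m' → m' < m → ¬ Walk G m' u w) →
             Dist G u w (just m)
  infinite : (∀ m → ¬ Walk G m u w) → Dist G u w nothing

Resolving : ∀ {n} → Graph n → Subset n → Set
Resolving {n} G R =
  ∀ (u w : Fin n) → u ≢ w →
    ∃[ r ] (r ∈ R × ∃[ d₁ ] ∃[ d₂ ] (Dist G u r d₁ × Dist G w r d₂ × d₁ ≢ d₂))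

IsMetricDim : ∀ {n} → Graph n → ℕ → Set
IsMetricDim {n} G d =
  (∃[ R ] (Resolving G R × ∣ R ∣ ≡ d)) × (∀ R → Resolving G R → d ≤ ∣ R ∣)

-- The incidence graph on Fin (v + v): first v vertices are points,
-- last v are blocks.

incidenceGraph : ∀ {v} → (Fin v → Fin v → Bool) → Graph (v + v)
incidenceGraph {v} inc a b with splitAt v a | splitAt v b
... | inj₁ x | inj₂ B = inc x B
... | inj₂ B | inj₁ x = inc x B
... | inj₁ _ | inj₁ _ = false
... | inj₂ _ | inj₂ _ = false

polarityGraph : ∀ {v} → (Fin v → Fin v → Bool) → (Fin v → Fin v) → Graph v
polarityGraph inc σ x y = if ⌊ x F.≟ y ⌋ then false else inc x (σ y)

-- In Γ, two points are at distance 0 or 2 and a point x and a block B at distance 1 or 3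
-- according as x ∈ B; in Δ, which has diameter 2, d(x, s) is 0, 1 or 2 according as x = s,
-- x ∈ σ(s) or neither.  Hence for a resolving set S of Δ, the vertices s and σ(s) (s ∈ S)
-- of Γ together determine d_Δ(x, s) for every point x, so they separate any two points.
-- The polarity induces an automorphism x ↦ σ(x), B ↦ σ⁻¹(B) of Γ that swaps points and blocks
-- and maps S ∪ σ(S) onto itself, so they separate any two blocks as well; a point and a block are
-- separated by parity.  Thus S ∪ σ(S), of size 2|S|, resolves Γ.
module Submission where

open import Defs
open import Data.Nat using (ℕ; zero; suc; _+_; _*_; _≤_; _<_; z≤n; s≤s; s≤s⁻¹)
import Data.Nat.Properties as ℕ
open import Data.Bool using (Bool; true; false; _∧_; if_then_else_)
open import Data.Fin as F using (Fin; zero; suc; _↑ˡ_; _↑ʳ_; splitAt; _≟_)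
import Data.Fin.Properties as F
open import Data.Fin.Subset using (Subset; inside; outside; ∣_∣) renaming (_∈_ to _∈ₛ_)
open import Data.Fin.Permutation using (Permutation′; permutation; _⟨$⟩ʳ_)
open import Data.Vec using ([]; _∷_; lookup; tabulate; _++_)
import Data.Vec.Properties as Vec
open import Data.Maybe using (just)
open import Data.Maybe.Properties using (just-injective)
open import Data.Product using (_×_; _,_; proj₁; proj₂; ∃-syntax; ∃₂)
open import Data.Sum using (_⊎_; inj₁; inj₂; [_,_]′)
open import Function using (_∘_)
open import Relation.Nullary using (yes; no; contradiction)
open import Relation.Nullary.Decidable using (⌊_⌋)
open import Relation.Binary using (tri<; tri≈; tri>)
open import Relation.Binary.PropositionalEquality
open import Algebra.Properties.CommutativeMonoid.Sum ℕ.+-0-commutativeMonoid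
  using (sum; sum-permute; sum-cong-≗)

private
  variable
    n : ℕ

1≤count : (p : Fin n → Bool) (i : Fin n) → p i ≡ true → 1 ≤ count p
1≤count p zero    pi≡true rewrite pi≡true = s≤s z≤n
1≤count p (suc i) pi≡true with p zero
... | true  = s≤s z≤n
... | false = 1≤count (p ∘ suc) i pi≡true

1≤count⇒∃ : (p : Fin n → Bool) → 1 ≤ count p → ∃[ i ] p i ≡ true
1≤count⇒∃ {suc n} p 1≤c with p zero in p0
... | true  = zero , p0
... | false = let i , pi = 1≤count⇒∃ (p ∘ suc) 1≤c in suc i , pi

2≤count⇒∃₂ : (p : Fin n → Bool) → 2 ≤ count p →
             ∃₂ λ i j → i ≢ j × p i ≡ true × p j ≡ true
2≤count⇒∃₂ {suc n} p 2≤c with p zero in p0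
... | true  = let j , pj = 1≤count⇒∃ (p ∘ suc) (s≤s⁻¹ 2≤c) in zero , suc j , (λ ()) , p0 , pj
... | false = let i , j , i≢j , pi , pj = 2≤count⇒∃₂ (p ∘ suc) 2≤c
              in suc i , suc j , i≢j ∘ F.suc-injective , pi , pj

∧-true : ∀ {a b} → a ∧ b ≡ true → a ≡ true × b ≡ true
∧-true {true} {true} _ = refl , refl

false≢true : false ≢ true
false≢true ()

module _ {G : Graph n} where

  walk₀⇒≡ : ∀ {u w} → Walk G 0 u w → u ≡ w
  walk₀⇒≡ [] = refl

  Dist-functional : ∀ {u w d d′} → Dist G u w d → Dist G u w d′ → d ≡ d′
  Dist-functional (finite {m} p shortest) (finite {m′} p′ shortest′) with ℕ.<-cmp m m′
  ... | tri< m<m′ _ _ = contradiction p (shortest′ m m<m′)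
  ... | tri≈ _ m≡m′ _ = cong just m≡m′
  ... | tri> _ _ m>m′ = contradiction p′ (shortest m′ m>m′)
  Dist-functional (finite p _) (infinite none)  = contradiction p (none _)
  Dist-functional (infinite none) (finite p _)  = contradiction p (none _)
  Dist-functional (infinite _) (infinite _)     = refl

  dist-refl : ∀ {u} → Dist G u u (just 0)
  dist-refl = finite [] λ _ ()

  dist-adjacent : ∀ {u w} → u ≢ w → G u w ≡ true → Dist G u w (just 1)
  dist-adjacent u≢w u~w = finite (u~w ∷ []) λ where
    0 _ p              → u≢w (walk₀⇒≡ p)
    (suc _) (s≤s ()) _

  dist-two : ∀ {u c w} → u ≢ w → G u w ≡ false → G u c ≡ true → G c w ≡ true →
             Dist G u w (just 2)
  dist-two u≢w u≁w u~c c~w = finite (u~c ∷ c~w ∷ []) λ where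
    0 _ p          → u≢w (walk₀⇒≡ p)
    1 _ (u~w ∷ []) → false≢true (trans (sym u≁w) u~w)
    (suc (suc _)) (s≤s (s≤s ())) _

  dist-three : ∀ {u w} → u ≢ w → G u w ≡ false →
               (∀ c → G u c ≡ true → G c w ≡ false) → Walk G 3 u w → Dist G u w (just 3)
  dist-three u≢w u≁w no-common p = finite p λ where
    0 _ p                  → u≢w (walk₀⇒≡ p)
    1 _ (u~w ∷ [])         → false≢true (trans (sym u≁w) u~w)
    2 _ (u~c ∷ c~w ∷ [])   → false≢true (trans (sym (no-common _ u~c)) c~w)
    (suc (suc (suc _))) (s≤s (s≤s (s≤s ()))) _

  diameter₂-dist : Fin n → Fin n → ℕ
  diameter₂-dist u w = if ⌊ u ≟ w ⌋ then 0 else if G u w then 1 else 2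

  Dist-diameter₂ : (∀ {u w} → u ≢ w → G u w ≡ false → ∃[ c ] (G u c ≡ true × G c w ≡ true)) →
                   ∀ u w → Dist G u w (just (diameter₂-dist u w))
  Dist-diameter₂ common u w with u ≟ w
  ... | yes refl = dist-refl
  ... | no u≢w with G u w in u?w
  ...   | true  = dist-adjacent u≢w u?w
  ...   | false = let _ , u~c , c~w = common u≢w u?w in dist-two u≢w u?w u~c c~w

  module _ (G-sym : ∀ u w → G u w ≡ G w u) where

    Walk-reverse : ∀ {m u w} → Walk G m u w → Walk G m w u
    Walk-reverse [] = []
    Walk-reverse (u~x ∷ p) = snoc (Walk-reverse p) (trans (G-sym _ _) u~x)
      where
      snoc : ∀ {m a b c} → Walk G m a b → G b c ≡ true → Walk G (suc m) a c
      snoc []      b~c = b~c ∷ []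
      snoc (e ∷ q) b~c = e ∷ snoc q b~c

    Dist-sym : ∀ {u w d} → Dist G u w d → Dist G w u d
    Dist-sym (finite p shortest) = finite (Walk-reverse p) λ m m< q → shortest m m< (Walk-reverse q)
    Dist-sym (infinite none)     = infinite λ m q → none m (Walk-reverse q)

  module _ (f : Fin n → Fin n) (f-involutive : ∀ u → f (f u) ≡ u)
           (G-f : ∀ u w → G (f u) (f w) ≡ G u w) where

    Walk-map : ∀ {m u w} → Walk G m u w → Walk G m (f u) (f w)
    Walk-map []        = []
    Walk-map (u~x ∷ p) = trans (G-f _ _) u~x ∷ Walk-map p

    Walk-unmap : ∀ {m u w} → Walk G m (f u) (f w) → Walk G m u w
    Walk-unmap {m} = subst₂ (Walk G m) (f-involutive _) (f-involutive _) ∘ Walk-map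

    Dist-map : ∀ {u w d} → Dist G u w d → Dist G (f u) (f w) d
    Dist-map (finite p shortest) = finite (Walk-map p) λ m m< q → shortest m m< (Walk-unmap q)
    Dist-map (infinite none)     = infinite λ m q → none m (Walk-unmap q)

Separated : Graph n → Subset n → Fin n → Fin n → Set
Separated G R u w = ∃[ r ] (r ∈ₛ R × ∃[ d₁ ] ∃[ d₂ ] (Dist G u r d₁ × Dist G w r d₂ × d₁ ≢ d₂))

module _ {G : Graph n} {R : Subset n} where

  separated-by : ∀ {u w r m₁ m₂} → r ∈ₛ R → Dist G u r (just m₁) → Dist G w r (just m₂) →
                 m₁ ≢ m₂ → Separated G R u w
  separated-by r∈R du dw m₁≢m₂ = _ , r∈R , _ , _ , du , dw , m₁≢m₂ ∘ just-injective

  Separated-sym : ∀ {u w} → Separated G R u w → Separated G R w u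
  Separated-sym (r , r∈R , d₁ , d₂ , du , dw , d₁≢d₂) = r , r∈R , d₂ , d₁ , dw , du , d₁≢d₂ ∘ sym

  Separated-dist : (δ : Fin n → Fin n → ℕ) → (∀ u r → Dist G u r (just (δ u r))) →
                   ∀ {u w} → Separated G R u w → ∃[ r ] (r ∈ₛ R × δ u r ≢ δ w r)
  Separated-dist δ dist (r , r∈R , _ , _ , du , dw , d₁≢d₂) =
    r , r∈R , λ δu≡δw → d₁≢d₂ (trans (Dist-functional du (dist _ r))
                                     (trans (cong just δu≡δw) (Dist-functional (dist _ r) dw)))

  Separated-map : (f : Fin n → Fin n) (f-involutive : ∀ u → f (f u) ≡ u)
                  (G-f : ∀ u w → G (f u) (f w) ≡ G u w) (R-f : ∀ {r} → r ∈ₛ R → f r ∈ₛ R) →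
                  ∀ {u w} → Separated G R u w → Separated G R (f u) (f w)
  Separated-map f f-inv G-f R-f (r , r∈R , d₁ , d₂ , du , dw , d₁≢d₂) =
    f r , R-f r∈R , d₁ , d₂ , Dist-map f f-inv G-f du , Dist-map f f-inv G-f dw , d₁≢d₂

Resolving⇒nonempty : {G : Graph n} {R : Subset n} → 1 < n → Resolving G R → ∃[ r ] r ∈ₛ R
Resolving⇒nonempty {suc zero} (s≤s ())
Resolving⇒nonempty {suc (suc _)} _ resolving =
  let r , r∈R , _ = resolving zero (suc zero) (λ ()) in r , r∈R

∣p++q∣ : ∀ {m} (p : Subset m) (q : Subset n) → ∣ p ++ q ∣ ≡ ∣ p ∣ + ∣ q ∣
∣p++q∣ []            q = refl
∣p++q∣ (inside ∷ p)  q = cong suc (∣p++q∣ p q)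
∣p++q∣ (outside ∷ p) q = ∣p++q∣ p q

∣p∣≡sum : (p : Subset n) → ∣ p ∣ ≡ sum (λ i → if lookup p i then 1 else 0)
∣p∣≡sum []            = refl
∣p∣≡sum (inside ∷ p)  = cong suc (∣p∣≡sum p)
∣p∣≡sum (outside ∷ p) = ∣p∣≡sum p

permute : Subset n → Permutation′ n → Subset n
permute p π = tabulate (lookup p ∘ (π ⟨$⟩ʳ_))

∣permute∣ : (p : Subset n) (π : Permutation′ n) → ∣ permute p π ∣ ≡ ∣ p ∣
∣permute∣ p π = begin
  ∣ permute p π ∣                                    ≡⟨ ∣p∣≡sum (permute p π) ⟩
  sum (λ i → indicator (lookup (permute p π) i))     ≡⟨ sum-cong-≗ (cong indicator ∘ lookup-permute) ⟩
  sum (λ i → indicator (lookup p (π ⟨$⟩ʳ i)))         ≡⟨ sum-permute (indicator ∘ lookup p) π ⟨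
  sum (λ i → indicator (lookup p i))                 ≡⟨ ∣p∣≡sum p ⟨
  ∣ p ∣                                              ∎
  where
  open ≡-Reasoning
  indicator : Bool → ℕ
  indicator b = if b then 1 else 0
  lookup-permute : ∀ i → lookup (permute p π) i ≡ lookup p (π ⟨$⟩ʳ i)
  lookup-permute = Vec.lookup∘tabulate (lookup p ∘ (π ⟨$⟩ʳ_))

∈-resp-lookup : ∀ {m} {p : Subset m} {q : Subset n} {i j} → lookup q j ≡ lookup p i → i ∈ₛ p → j ∈ₛ q
∈-resp-lookup {p = p} {q} {i} {j} qj≡pi i∈p = Vec.lookup⇒[]= j q (trans qj≡pi (Vec.[]=⇒lookup i∈p))

module IncidenceGraph {v} (inc : Fin v → Fin v → Bool) where

  Γ : Graph (v + v)
  Γ = incidenceGraph inc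

  pt bl : Fin v → Fin (v + v)
  pt x = x ↑ˡ v
  bl B = v ↑ʳ B

  Γ-pt-bl : ∀ x B → Γ (pt x) (bl B) ≡ inc x B
  Γ-pt-bl x B rewrite F.splitAt-↑ˡ v x v | F.splitAt-↑ʳ v v B = refl

  Γ-bl-pt : ∀ B x → Γ (bl B) (pt x) ≡ inc x B
  Γ-bl-pt B x rewrite F.splitAt-↑ˡ v x v | F.splitAt-↑ʳ v v B = refl

  Γ-pt-pt : ∀ x y → Γ (pt x) (pt y) ≡ false
  Γ-pt-pt x y rewrite F.splitAt-↑ˡ v x v | F.splitAt-↑ˡ v y v = refl

  Γ-bl-bl : ∀ B C → Γ (bl B) (bl C) ≡ false
  Γ-bl-bl B C rewrite F.splitAt-↑ʳ v v B | F.splitAt-↑ʳ v v C = refl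

  pt-injective : ∀ {x y} → pt x ≡ pt y → x ≡ y
  pt-injective = F.↑ˡ-injective v _ _

  pt≢bl : ∀ x B → pt x ≢ bl B
  pt≢bl x B eq with trans (sym (F.splitAt-↑ˡ v x v)) (trans (cong (splitAt v) eq) (F.splitAt-↑ʳ v v B))
  ... | ()

  data View : Fin (v + v) → Set where
    point : ∀ x → View (pt x)
    block : ∀ B → View (bl B)

  view : ∀ a → View a
  view a with splitAt v a in eq
  ... | inj₁ x = subst View (F.splitAt⁻¹-↑ˡ eq) (point x)
  ... | inj₂ B = subst View (F.splitAt⁻¹-↑ʳ eq) (block B)

  Γ-sym : ∀ a b → Γ a b ≡ Γ b a
  Γ-sym a b with view a | view b
  ... | point x | point y = trans (Γ-pt-pt x y) (sym (Γ-pt-pt y x))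
  ... | point x | block B = trans (Γ-pt-bl x B) (sym (Γ-bl-pt B x))
  ... | block B | point x = trans (Γ-bl-pt B x) (sym (Γ-pt-bl x B))
  ... | block B | block C = trans (Γ-bl-bl B C) (sym (Γ-bl-bl C B))

  pt-bl-no-common-neighbour : ∀ x B c → Γ (pt x) c ≡ true → Γ c (bl B) ≡ false
  pt-bl-no-common-neighbour x B c x~c with view c
  ... | point y = contradiction (trans (sym (Γ-pt-pt x y)) x~c) false≢true
  ... | block C = Γ-bl-bl C B

  ∉∈⇒≢ : ∀ {x y B} → inc x B ≡ false → inc y B ≡ true → x ≢ y
  ∉∈⇒≢ x∉B y∈B refl = false≢true (trans (sym x∉B) y∈B)

  pt-dist : Fin v → Fin v → ℕ
  pt-dist x y = if ⌊ x ≟ y ⌋ then 0 else 2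

  pt-bl-dist : Fin v → Fin v → ℕ
  pt-bl-dist x B = if inc x B then 1 else 3

  pt-dist≢pt-bl-dist : ∀ x y z B → pt-dist x y ≢ pt-bl-dist z B
  pt-dist≢pt-bl-dist x y z B with ⌊ x ≟ y ⌋ | inc z B
  ... | true  | true  = λ ()
  ... | true  | false = λ ()
  ... | false | true  = λ ()
  ... | false | false = λ ()

  pt-bl-dist-injective : ∀ x y B C → pt-bl-dist x B ≡ pt-bl-dist y C → inc x B ≡ inc y C
  pt-bl-dist-injective x y B C with inc x B | inc y C
  ... | true  | true  = λ _ → refl
  ... | false | false = λ _ → refl
  ... | true  | false = λ ()
  ... | false | true  = λ ()

module SymmetricDesign {v k lam inc} (design : IsSymmetricDesign v k lam inc)
                       (nontrivial : NonTrivial v k) where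
  open IsSymmetricDesign design
  open IncidenceGraph inc

  1<k : 1 < k
  1<k = proj₁ nontrivial

  block-nonempty : ∀ B → ∃[ x ] inc x B ≡ true
  block-nonempty B = 1≤count⇒∃ _ (subst (1 ≤_) (sym (blockSize B)) (ℕ.<⇒≤ 1<k))

  1<v : 1 < v
  1<v = ℕ.<-trans 1<k (ℕ.<-trans (ℕ.n<1+n k) (proj₂ nontrivial))

  B₀ : Fin v
  B₀ = F.fromℕ< (ℕ.<-trans (s≤s z≤n) 1<v)

  -- Some block has two points, which then lie in λ ≥ 1 common blocks.
  1≤λ : 1 ≤ lam
  1≤λ with 2≤count⇒∃₂ (λ x → inc x B₀) (subst (2 ≤_) (sym (blockSize B₀)) 1<k)
  ... | x , y , x≢y , x∈B₀ , y∈B₀ =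
    subst (1 ≤_) (pointPairs x y x≢y) (1≤count (λ B → inc x B ∧ inc y B) B₀ (cong₂ _∧_ x∈B₀ y∈B₀))

  common-block : ∀ {x y} → x ≢ y → ∃[ C ] (inc x C ≡ true × inc y C ≡ true)
  common-block {x} {y} x≢y =
    let C , xy∈C = 1≤count⇒∃ _ (subst (1 ≤_) (sym (pointPairs x y x≢y)) 1≤λ) in C , ∧-true xy∈C

  common-point : ∀ {B C} → B ≢ C → ∃[ z ] (inc z B ≡ true × inc z C ≡ true)
  common-point {B} {C} B≢C =
    let z , z∈BC = 1≤count⇒∃ _ (subst (1 ≤_) (sym (blockPairs B C B≢C)) 1≤λ) in z , ∧-true z∈BC

  dist-pt-pt : ∀ x y → Dist Γ (pt x) (pt y) (just (pt-dist x y))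
  dist-pt-pt x y with x ≟ y
  ... | yes refl = dist-refl
  ... | no x≢y   = let C , x∈C , y∈C = common-block x≢y in
    dist-two (x≢y ∘ pt-injective) (Γ-pt-pt x y) (trans (Γ-pt-bl x C) x∈C) (trans (Γ-bl-pt C y) y∈C)

  -- For x ∉ B pick y ∈ B; a block C through x and y gives the path x, C, y, B.
  dist-pt-bl : ∀ x B → Dist Γ (pt x) (bl B) (just (pt-bl-dist x B))
  dist-pt-bl x B with inc x B in x?B
  ... | true  = dist-adjacent (pt≢bl x B) (trans (Γ-pt-bl x B) x?B)
  ... | false with block-nonempty B
  ...   | y , y∈B with common-block (∉∈⇒≢ x?B y∈B)
  ...     | C , x∈C , y∈C =
    dist-three (pt≢bl x B) (trans (Γ-pt-bl x B) x?B) (pt-bl-no-common-neighbour x B)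
      (trans (Γ-pt-bl x C) x∈C ∷ trans (Γ-bl-pt C y) y∈C ∷ trans (Γ-pt-bl y B) y∈B ∷ [])

module Polarity {v inc σ} (polarity : IsPolarity {v} inc σ) where
  open IsPolarity polarity
  open IncidenceGraph inc

  σ⁻¹ : Fin v → Fin v
  σ⁻¹ B = proj₁ (proj₂ bijective B)

  σ∘σ⁻¹ : ∀ B → σ (σ⁻¹ B) ≡ B
  σ∘σ⁻¹ B = proj₂ (proj₂ bijective B) refl

  σ⁻¹∘σ : ∀ x → σ⁻¹ (σ x) ≡ x
  σ⁻¹∘σ x = proj₁ bijective (σ∘σ⁻¹ (σ x))

  σ⁻¹-permutation : Permutation′ v
  σ⁻¹-permutation = permutation σ⁻¹ σ σ⁻¹∘σ σ∘σ⁻¹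

  dual : Fin (v + v) → Fin (v + v)
  dual = [ bl ∘ σ , pt ∘ σ⁻¹ ]′ ∘ splitAt v

  dual-pt : ∀ x → dual (pt x) ≡ bl (σ x)
  dual-pt x rewrite F.splitAt-↑ˡ v x v = refl

  dual-bl : ∀ B → dual (bl B) ≡ pt (σ⁻¹ B)
  dual-bl B rewrite F.splitAt-↑ʳ v v B = refl

  dual-involutive : ∀ a → dual (dual a) ≡ a
  dual-involutive a with view a
  ... | point x rewrite dual-pt x | dual-bl (σ x) = cong pt (σ⁻¹∘σ x)
  ... | block B rewrite dual-bl B | dual-pt (σ⁻¹ B) = cong bl (σ∘σ⁻¹ B)

  inc-σ⁻¹-σ : ∀ x B → inc (σ⁻¹ B) (σ x) ≡ inc x B
  inc-σ⁻¹-σ x B = trans (symmetric (σ⁻¹ B) x) (cong (inc x) (σ∘σ⁻¹ B))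

  Γ-dual : ∀ a b → Γ (dual a) (dual b) ≡ Γ a b
  Γ-dual a b with view a | view b
  ... | point x | point y rewrite dual-pt x | dual-pt y = trans (Γ-bl-bl _ _) (sym (Γ-pt-pt x y))
  ... | block B | block C rewrite dual-bl B | dual-bl C = trans (Γ-pt-pt _ _) (sym (Γ-bl-bl B C))
  ... | point x | block B rewrite dual-pt x | dual-bl B =
    trans (Γ-bl-pt _ _) (trans (inc-σ⁻¹-σ x B) (sym (Γ-pt-bl x B)))
  ... | block B | point x rewrite dual-bl B | dual-pt x =
    trans (Γ-pt-bl _ _) (trans (inc-σ⁻¹-σ x B) (sym (Γ-bl-pt B x)))

  -- S ∪ σ(S): its block B belongs to it iff σ⁻¹ B ∈ S.
  lift : Subset v → Subset (v + v)
  lift S = S ++ permute S σ⁻¹-permutation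

  ∣lift∣ : ∀ S → ∣ lift S ∣ ≡ 2 * ∣ S ∣
  ∣lift∣ S = begin
    ∣ lift S ∣                   ≡⟨ ∣p++q∣ S (permute S σ⁻¹-permutation) ⟩
    ∣ S ∣ + ∣ permute S σ⁻¹-permutation ∣ ≡⟨ cong (∣ S ∣ +_) (∣permute∣ S σ⁻¹-permutation) ⟩
    ∣ S ∣ + ∣ S ∣                ≡⟨ cong (∣ S ∣ +_) (ℕ.+-identityʳ ∣ S ∣) ⟨
    2 * ∣ S ∣                    ∎
    where open ≡-Reasoning

  lookup-lift-pt : ∀ S x → lookup (lift S) (pt x) ≡ lookup S x
  lookup-lift-pt S x = Vec.lookup-++ˡ S _ x

  lookup-lift-bl : ∀ S B → lookup (lift S) (bl B) ≡ lookup S (σ⁻¹ B)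
  lookup-lift-bl S B = trans (Vec.lookup-++ʳ S _ B) (Vec.lookup∘tabulate _ B)

  lookup-lift-dual : ∀ S a → lookup (lift S) (dual a) ≡ lookup (lift S) a
  lookup-lift-dual S a with view a
  ... | point x rewrite dual-pt x =
    trans (lookup-lift-bl S (σ x)) (trans (cong (lookup S) (σ⁻¹∘σ x)) (sym (lookup-lift-pt S x)))
  ... | block B rewrite dual-bl B =
    trans (lookup-lift-pt S (σ⁻¹ B)) (sym (lookup-lift-bl S B))

  pt∈lift : ∀ {S x} → x ∈ₛ S → pt x ∈ₛ lift S
  pt∈lift {S} {x} = ∈-resp-lookup (lookup-lift-pt S x)

  bl∈lift : ∀ {S x} → x ∈ₛ S → bl (σ x) ∈ₛ lift S
  bl∈lift {S} {x} x∈S = subst (_∈ₛ lift S) (dual-pt x)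
                              (∈-resp-lookup (lookup-lift-dual S (pt x)) (pt∈lift x∈S))

  dual-separated : ∀ {S a b} → Separated Γ (lift S) a b → Separated Γ (lift S) (dual a) (dual b)
  dual-separated {S} = Separated-map dual dual-involutive Γ-dual
                         (∈-resp-lookup (lookup-lift-dual S _))

module NullPolarity {v k lam inc σ} (design : IsSymmetricDesign v k lam inc)
                    (nontrivial : NonTrivial v k) (polarity : IsPolarity inc σ)
                    (null : IsNull inc σ) where
  open IsPolarity polarity
  open IncidenceGraph inc
  open SymmetricDesign design nontrivial
  open Polarity polarity

  Δ : Graph v
  Δ = polarityGraph inc σ

  Δ-adjacent : ∀ {x y} → x ≢ y → Δ x y ≡ inc x (σ y)
  Δ-adjacent {x} {y} x≢y with x ≟ y
  ... | yes x≡y = contradiction x≡y x≢y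
  ... | no _    = refl

  -- A common point z of σ(x) and σ(y) is a common neighbour; z ≠ x, y since σ is null.
  Δ-common-neighbour : ∀ {x y} → x ≢ y → Δ x y ≡ false → ∃[ z ] (Δ x z ≡ true × Δ z y ≡ true)
  Δ-common-neighbour {x} {y} x≢y _ with common-point (x≢y ∘ proj₁ bijective)
  ... | z , z∈σx , z∈σy =
    z , trans (Δ-adjacent (∉∈⇒≢ (null x) z∈σx)) (trans (symmetric x z) z∈σx)
      , trans (Δ-adjacent (∉∈⇒≢ (null y) z∈σy ∘ sym)) z∈σy

  dist-Δ : ∀ x s → Dist Δ x s (just (diameter₂-dist {G = Δ} x s))
  dist-Δ = Dist-diameter₂ Δ-common-neighbour

  Δ-dist≢-cases : ∀ {x y s} → diameter₂-dist {G = Δ} x s ≢ diameter₂-dist {G = Δ} y s →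
                     pt-dist x s ≢ pt-dist y s ⊎ inc x (σ s) ≢ inc y (σ s)
  Δ-dist≢-cases {x} {y} {s} ≢ with x ≟ s | y ≟ s
  ... | yes _ | yes _ = inj₁ ≢
  ... | yes _ | no _  = inj₁ λ ()
  ... | no _  | yes _ = inj₁ λ ()
  ... | no _  | no _  = inj₂ (≢ ∘ cong λ b → if b then 1 else 2)

  module _ {S : Subset v} (S-resolves : Resolving Δ S) where

    points-separated : ∀ {x y} → x ≢ y → Separated Γ (lift S) (pt x) (pt y)
    points-separated x≢y with Separated-dist (diameter₂-dist {G = Δ}) dist-Δ (S-resolves _ _ x≢y)
    ... | s , s∈S , Δ-dist≢ with Δ-dist≢-cases Δ-dist≢
    ...   | inj₁ pt-dist≢ = separated-by (pt∈lift s∈S) (dist-pt-pt _ s) (dist-pt-pt _ s) pt-dist≢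
    ...   | inj₂ inc≢     = separated-by (bl∈lift s∈S) (dist-pt-bl _ (σ s)) (dist-pt-bl _ (σ s))
                              (inc≢ ∘ pt-bl-dist-injective _ _ (σ s) (σ s))

    blocks-separated : ∀ {B C} → B ≢ C → Separated Γ (lift S) (bl B) (bl C)
    blocks-separated {B} {C} B≢C =
      subst₂ (Separated Γ (lift S)) (trans (dual-pt (σ⁻¹ B)) (cong bl (σ∘σ⁻¹ B)))
                                    (trans (dual-pt (σ⁻¹ C)) (cong bl (σ∘σ⁻¹ C)))
        (dual-separated (points-separated (B≢C ∘ σ⁻¹-injective)))
      where
      σ⁻¹-injective : σ⁻¹ B ≡ σ⁻¹ C → B ≡ C
      σ⁻¹-injective eq = trans (sym (σ∘σ⁻¹ B)) (trans (cong σ eq) (σ∘σ⁻¹ C))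

    point-block-separated : ∀ x B → Separated Γ (lift S) (pt x) (bl B)
    point-block-separated x B with Resolving⇒nonempty 1<v S-resolves
    ... | s , s∈S = separated-by (pt∈lift s∈S) (dist-pt-pt x s) (Dist-sym Γ-sym (dist-pt-bl s B))
                      (pt-dist≢pt-bl-dist x s s B)

    lift-resolves : Resolving Γ (lift S)
    lift-resolves a b a≢b with view a | view b
    ... | point x | point y = points-separated (a≢b ∘ cong pt)
    ... | block B | block C = blocks-separated (a≢b ∘ cong bl)
    ... | point x | block B = point-block-separated x B
    ... | block B | point x = Separated-sym (point-block-separated x B)

theorem4p5 : (v k lam : ℕ) (inc : Fin v → Fin v → Bool) (σ : Fin v → Fin v) →
    IsSymmetricDesign v k lam inc → NonTrivial v k →
    IsPolarity inc σ → IsNull inc σ →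
    (dΓ dΔ : ℕ) →
    IsMetricDim (incidenceGraph inc) dΓ →
    IsMetricDim (polarityGraph inc σ) dΔ →
    dΓ ≤ 2 * dΔ
theorem4p5 v k lam inc σ design nontrivial polarity null dΓ dΔ
           (_ , Γ-minimal) ((S , S-resolves , ∣S∣≡dΔ) , _) = begin
  dΓ              ≤⟨ Γ-minimal (lift S) (lift-resolves S-resolves) ⟩
  ∣ lift S ∣      ≡⟨ ∣lift∣ S ⟩
  2 * ∣ S ∣       ≡⟨ cong (2 *_) ∣S∣≡dΔ ⟩
  2 * dΔ          ∎
  where
  open ℕ.≤-Reasoning
  open Polarity polarity
  open NullPolarity design nontrivial polarity null
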